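{- Let $\mathrm{U}$ be a countable homogeneous relational structure whose age is a free amalgamation age. Then the typeset $\sigma(\underline T)$ is infinite for every type $\underline T$ of $\mathrm{U}$.
   Context: Relational languages have no $0$-ary symbols; relations hold only on distinct entries. Homogeneous: every isomorphism between finite induced substructures extends to an automorphism. Free amalgamation age: closed under induced substructures and free amalgams (the union of two structures agreeing on a common part in which no relation holds on a tuple meeting both non-common parts). With $\mathrm{G}$ the automorphism group and $\mathrm{G}_F$ the pointwise stabilizer of $F$, a type is $\langle F\mid x\rangle$ with $F\subseteq U$ finite, $x\in U\setminus F$, and its typeset is $\{g(x):g\in\mathrm{G}_F\}$. -}

module Defs where

open import Data.Nat using (ℕ; _≤_)
open import Data.Fin using (Fin)
open import Data.Bool using (Bool; T)
open import Data.List using (List)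
open import Data.List.Membership.Propositional using (_∈_)
open import Data.Product using (Σ; _×_; proj₁)
open import Data.Sum using (_⊎_)
open import Relation.Nullary using (¬_)
open import Relation.Binary.PropositionalEquality using (_≡_)
open import Function using (_∘_)
open import Function.Bundles using (_↔_; _⇔_; Inverse)
open import Function.Definitions using (Injective)

record Language : Set₁ where
  field
    Sym       : Set
    arity     : Sym → ℕ
    arity-pos : ∀ s → 1 ≤ arity s
open Language public

record Structure (L : Language) : Set₁ where
  field
    Carrier : Set
    Rel     : (s : Sym L) → (Fin (arity L s) → Carrier) → Set
open Structure public

module _ {L : Language} where

  RelationsOnDistinct : Structure L → Set
  RelationsOnDistinct U = ∀ s (t : Fin (arity L s) → Carrier U) →
    Rel U s t → Injective _≡_ _≡_ t

  Countable : Structure L → Set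
  Countable U = Σ (Carrier U → ℕ) (Injective _≡_ _≡_)

  record Automorphism (U : Structure L) : Set where
    field
      iso      : Carrier U ↔ Carrier U
      preserve : ∀ s (t : Fin (arity L s) → Carrier U) →
                 Rel U s t ⇔ Rel U s (Inverse.to iso ∘ t)

  aut : {U : Structure L} → Automorphism U → Carrier U → Carrier U
  aut g = Inverse.to (Automorphism.iso g)

  -- Homogeneity: every isomorphism between finite induced substructures
  -- (given by an injective enumeration a of the domain and its image b)
  -- extends to an automorphism.
  Homogeneous : Structure L → Set
  Homogeneous U = ∀ (n : ℕ) (a b : Fin n → Carrier U) →
    Injective _≡_ _≡_ a → Injective _≡_ _≡_ b →
    (∀ s (t : Fin (arity L s) → Fin n) → Rel U s (a ∘ t) ⇔ Rel U s (b ∘ t)) →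
    Σ (Automorphism U) (λ g → ∀ i → aut g (a i) ≡ b i)

  Embedding : Structure L → Structure L → Set
  Embedding B U = Σ (Carrier B → Carrier U) (λ f →
    Injective _≡_ _≡_ f ×
    (∀ s (t : Fin (arity L s) → Carrier B) → Rel B s t ⇔ Rel U s (f ∘ t)))

  IsFinite : Structure L → Set
  IsFinite B = Σ ℕ (λ n → Carrier B ↔ Fin n)

  Age : Structure L → Structure L → Set
  Age U B = IsFinite B × Embedding B U

  Induced : (B : Structure L) → (Carrier B → Bool) → Structure L
  Induced B P = record
    { Carrier = Σ (Carrier B) (λ x → T (P x))
    ; Rel     = λ s t → Rel B s (proj₁ ∘ t) }

  -- A free amalgam is a finite structure D = B ∪ C whose
  -- restrictions to B and C lie in the class and in which every relation
  -- tuple lies entirely in B or entirely in C (i.e. no relation holds on a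
  -- tuple meeting both B ∖ C and C ∖ B).
  IsFreeAmalgamationClass : (Structure L → Set) → Set₁
  IsFreeAmalgamationClass K =
    (∀ B → K B → (P : Carrier B → Bool) → K (Induced B P)) ×
    (∀ D → IsFinite D → (PB PC : Carrier D → Bool) →
      (∀ x → T (PB x) ⊎ T (PC x)) →
      K (Induced D PB) → K (Induced D PC) →
      (∀ s (t : Fin (arity L s) → Carrier D) → Rel D s t →
         (∀ i → T (PB (t i))) ⊎ (∀ i → T (PC (t i)))) →
      K D)

  -- the typeset of the type ⟨F | x⟩: { g x : g ∈ G_F }
  InTypeset : (U : Structure L) → List (Carrier U) → Carrier U → Carrier U → Set
  InTypeset U F x y = Σ (Automorphism U) (λ g →
    (∀ f → f ∈ F → aut g f ≡ f) × aut g x ≡ y)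

  Infinite : (U : Structure L) → (Carrier U → Set) → Set
  Infinite U S = ¬ Σ (List (Carrier U)) (λ l → ∀ y → S y → y ∈ l)

module Submission where

-- Suppose the typeset of ⟨F | x⟩ were covered by a finite list l.  Enumerate
-- F ∪ l without repetition and form the finite structure D on {∗} ∪ F ∪ l
-- which is the free amalgam over F of B = F ∪ l (a copy of U) and of
-- C = F ∪ {∗}, where ∗ is a fresh copy of x.  Both parts embed into U, so
-- free amalgamation puts D into the age of U, giving an embedding E of D.
-- Homogeneity yields h with h ∘ E = id on B; the point y = h (E ∗) then lies
-- outside l, because E is injective and ∗ ∉ B.  Homogeneity again yields g
-- with g = h ∘ E on C (reading x for ∗); g fixes F and sends x to y, so y is
-- in the typeset after all.

open import Defs
open import Data.List using (List; _++_; length; lookup; deduplicate)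
open import Data.List.Membership.Propositional using (_∉_; _∈_)
open import Data.List.Membership.Propositional.Properties
  using (∈-++⁺ˡ; ∈-++⁺ʳ; ∈-lookup; ∈-deduplicate⁺)
open import Data.List.Membership.DecPropositional using (_∈?_)
open import Data.List.Relation.Unary.Any using (index)
open import Data.List.Relation.Unary.Any.Properties using (lookup-index)
import Data.List.Relation.Unary.All as All
open import Data.List.Relation.Unary.Unique.Propositional using (Unique)
open import Data.List.Relation.Unary.AllPairs using (_∷_)
open import Data.List.Relation.Unary.Unique.DecPropositional.Properties
  using (deduplicate-!)
open import Data.Nat using (ℕ; zero; suc)
import Data.Nat as ℕ
open import Data.Fin using (Fin; zero; suc)
open import Data.Fin.Properties using (1↔⊤; +↔⊎)
open import Data.Bool using (Bool; true; false; T; if_then_else_)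
open import Data.Bool.Properties using (T-irrelevant)
open import Data.Unit using (tt)
open import Data.Empty using (⊥-elim)
open import Data.Product using (Σ; _×_; _,_; proj₁; proj₂; ∃)
open import Data.Sum using (_⊎_; inj₁; inj₂; [_,_])
open import Data.Sum.Function.Propositional using (_⊎-↔_)
open import Relation.Nullary using (yes; no)
open import Relation.Nullary.Decidable using (isYes; fromWitness; toWitness)
open import Relation.Binary.Definitions using (DecidableEquality)
open import Relation.Binary.PropositionalEquality
  using (_≡_; refl; sym; trans; cong; subst; module ≡-Reasoning)
open import Function using (_∘_; id)
open import Function.Bundles using (_↔_; _⇔_; Inverse; Injection; mk↔ₛ′; mk⇔)
open import Function.Definitions using (Injective)
open import Function.Properties.Inverse using (↔-sym; ↔-trans; Inverse⇒Injection)
import Function.Properties.Equivalence as ⇔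

Σ-Fin-suc : ∀ {n} {Q : Fin (suc n) → Set} →
  Σ (Fin (suc n)) Q ↔ (Q zero ⊎ Σ (Fin n) (Q ∘ suc))
Σ-Fin-suc {n} {Q} = mk↔ₛ′ split join split∘join join∘split
  where
  split : Σ (Fin (suc n)) Q → Q zero ⊎ Σ (Fin n) (Q ∘ suc)
  split (zero  , q) = inj₁ q
  split (suc i , q) = inj₂ (i , q)
  join : Q zero ⊎ Σ (Fin n) (Q ∘ suc) → Σ (Fin (suc n)) Q
  join (inj₁ q)       = zero , q
  join (inj₂ (i , q)) = suc i , q
  split∘join : ∀ u → split (join u) ≡ u
  split∘join (inj₁ _) = refl
  split∘join (inj₂ _) = refl
  join∘split : ∀ u → join (split u) ≡ u
  join∘split (zero  , _) = refl
  join∘split (suc _ , _) = refl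

T-⊎-Fin : ∀ {A : Set} {k} (b : Bool) → A ↔ Fin k →
  (T b ⊎ A) ↔ Fin (if b then suc k else k)
T-⊎-Fin true  A↔k = ↔-trans (↔-sym 1↔⊤ ⊎-↔ A↔k) (↔-sym +↔⊎)
T-⊎-Fin false A↔k =
  ↔-trans (mk↔ₛ′ [ (λ ()) , id ] inj₂ (λ _ → refl) [ (λ ()) , (λ _ → refl) ]) A↔k

subset-finite : ∀ n (P : Fin n → Bool) → Σ ℕ (λ k → Σ (Fin n) (T ∘ P) ↔ Fin k)
subset-finite zero    P = 0 , mk↔ₛ′ (λ { (() , _) }) (λ ()) (λ ()) (λ { (() , _) })
subset-finite (suc n) P =
  _ , ↔-trans Σ-Fin-suc (T-⊎-Fin (P zero) (proj₂ (subset-finite n (P ∘ suc))))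

Σ-T-≡ : ∀ {A : Set} {P : A → Bool} {u v : Σ A (T ∘ P)} → proj₁ u ≡ proj₁ v → u ≡ v
Σ-T-≡ {u = a , p} {v = .a , q} refl = cong (a ,_) (T-irrelevant p q)

InjectiveOn : ∀ {A B : Set} → (A → Bool) → (A → B) → Set
InjectiveOn P f = ∀ {i j} → T (P i) → T (P j) → f i ≡ f j → i ≡ j

restrict-injective : ∀ {A B : Set} {P : A → Bool} {f : A → B} →
  InjectiveOn P f → Injective _≡_ _≡_ (f ∘ proj₁ {B = T ∘ P})
restrict-injective f-inj {u} {v} eq = Σ-T-≡ (f-inj (proj₂ u) (proj₂ v) eq)

lookup-injective : ∀ {A : Set} {xs : List A} → Unique xs → Injective _≡_ _≡_ (lookup xs)
lookup-injective (_ ∷ _)    {zero}  {zero}  _  = refl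
lookup-injective (x∉ ∷ _)   {zero}  {suc j} eq = ⊥-elim (All.lookup x∉ (∈-lookup j) eq)
lookup-injective (x∉ ∷ _)   {suc i} {zero}  eq = ⊥-elim (All.lookup x∉ (∈-lookup i) (sym eq))
lookup-injective (_ ∷ xs!)  {suc i} {suc j} eq = cong suc (lookup-injective xs! eq)

record Enumeration {A : Set} (xs : List A) : Set where
  field
    size   : ℕ
    elem   : Fin size → A
    elem-injective : Injective _≡_ _≡_ elem
    elem-covers    : ∀ {y} → y ∈ xs → ∃ λ i → elem i ≡ y

enumerate : ∀ {A : Set} → DecidableEquality A → (xs : List A) → Enumeration xs
enumerate _≟_ xs = record
  { size = length ys
  ; elem = lookup ys
  ; elem-injective = lookup-injective (deduplicate-! _≟_ xs)
  ; elem-covers = λ y∈xs → let y∈ys = ∈-deduplicate⁺ _≟_ y∈xs in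
                           index y∈ys , sym (lookup-index y∈ys)
  }
  where ys = deduplicate _≟_ xs

module _ {L : Language} (U : Structure L) where

  countable-decEq : Countable U → DecidableEquality (Carrier U)
  countable-decEq (code , code-inj) a b with code a ℕ.≟ code b
  ... | yes eq = yes (code-inj eq)
  ... | no neq = no (neq ∘ cong code)

  aut-injective : (g : Automorphism U) → Injective _≡_ _≡_ (aut g)
  aut-injective g = Injection.injective (Inverse⇒Injection (Automorphism.iso g))

  SameRelationsOn : ∀ {X : Set} → (X → Bool) → (X → Carrier U) → (X → Carrier U) → Set
  SameRelationsOn {X} P a b = ∀ s (t : Fin (arity L s) → X) →
    (∀ i → T (P (t i))) → Rel U s (a ∘ t) ⇔ Rel U s (b ∘ t)

  extend-finite : Homogeneous U → ∀ {X : Set} {k} → X ↔ Fin k →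
    (a b : X → Carrier U) → Injective _≡_ _≡_ a → Injective _≡_ _≡_ b →
    (∀ s (t : Fin (arity L s) → X) → Rel U s (a ∘ t) ⇔ Rel U s (b ∘ t)) →
    Σ (Automorphism U) (λ g → ∀ u → aut g (a u) ≡ b u)
  extend-finite hom {k = k} X↔k a b a-inj b-inj same
    with hom k (a ∘ from) (b ∘ from) (from-inj ∘ a-inj) (from-inj ∘ b-inj)
             (λ s t → same s (from ∘ t))
    where
    open Inverse X↔k using (from)
    from-inj : Injective _≡_ _≡_ from
    from-inj = Injection.injective (Inverse⇒Injection (↔-sym X↔k))
  ... | g , g-ext = g , λ u →
    subst (λ v → aut g (a v) ≡ b v) (Inverse.strictlyInverseʳ X↔k u) (g-ext (Inverse.to X↔k u))

  extend-on : Homogeneous U → ∀ {n} (P : Fin n → Bool) (a b : Fin n → Carrier U) →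
    InjectiveOn P a → InjectiveOn P b → SameRelationsOn P a b →
    Σ (Automorphism U) (λ g → ∀ i → T (P i) → aut g (a i) ≡ b i)
  extend-on hom {n} P a b a-inj b-inj same
    with extend-finite hom (proj₂ (subset-finite n P)) (a ∘ proj₁) (b ∘ proj₁)
           (restrict-injective a-inj) (restrict-injective b-inj)
           (λ s t → same s (proj₁ ∘ t) (proj₂ ∘ t))
  ... | g , g-ext = g , λ i i∈P → g-ext (i , i∈P)

module FreeAmalgam {L : Language} (U : Structure L) {n : ℕ}
  (point : Fin n → Carrier U) (PB PC : Fin n → Bool) where

  Within : (Fin n → Bool) → ∀ {s} → (Fin (arity L s) → Fin n) → Set
  Within P t = ∀ i → T (P (t i))

  Amalgam : Structure L
  Amalgam = record
    { Carrier = Fin n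
    ; Rel     = λ s t → (Within PB t ⊎ Within PC t) × Rel U s (point ∘ t) }

  within-part : ∀ {s} {t : Fin (arity L s) → Fin n} →
    Within PB t ⊎ Within PC t → Rel Amalgam s t ⇔ Rel U s (point ∘ t)
  within-part w = mk⇔ proj₂ (w ,_)

  part-in-age : (P : Fin n → Bool) → InjectiveOn P point →
    (∀ {s} (t : Fin (arity L s) → Fin n) → Within P t → Within PB t ⊎ Within PC t) →
    Age U (Induced Amalgam P)
  part-in-age P inj within =
    subset-finite n P , point ∘ proj₁ , restrict-injective inj ,
    λ s t → within-part (within (proj₁ ∘ t) (proj₂ ∘ t))

  amalgam-in-age : IsFreeAmalgamationClass (Age U) → (∀ i → T (PB i) ⊎ T (PC i)) →
    InjectiveOn PB point → InjectiveOn PC point → Age U Amalgam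
  amalgam-in-age (_ , amalgamate) covers injB injC =
    amalgamate Amalgam (n , mk↔ₛ′ id id (λ _ → refl) (λ _ → refl)) PB PC covers
      (part-in-age PB injB (λ _ → inj₁)) (part-in-age PC injC (λ _ → inj₂))
      (λ _ _ → proj₁)

module TypesetInfinite {L : Language} (U : Structure L) (cnt : Countable U)
  (hom : Homogeneous U) (fac : IsFreeAmalgamationClass (Age U))
  (F : List (Carrier U)) (x : Carrier U) (x∉F : x ∉ F) (l : List (Carrier U)) where

  _≟_ : DecidableEquality (Carrier U)
  _≟_ = countable-decEq U cnt

  open Enumeration (enumerate _≟_ (F ++ l))

  -- Index zero is the fresh copy ∗ of x; index suc i is elem i ∈ F ∪ l.
  point : Fin (suc size) → Carrier U
  point zero    = x
  point (suc i) = elem i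

  -- B = F ∪ l and C = {∗} ∪ F.
  inB inC : Fin (suc size) → Bool
  inB zero    = false
  inB (suc i) = true
  inC zero    = true
  inC (suc i) = isYes (_∈?_ _≟_ (elem i) F)

  covers : ∀ i → T (inB i) ⊎ T (inC i)
  covers zero    = inj₂ tt
  covers (suc i) = inj₁ tt

  point-injective-B : InjectiveOn inB point
  point-injective-B {suc i} {suc j} _ _ eq = cong suc (elem-injective eq)

  point-injective-C : InjectiveOn inC point
  point-injective-C {zero}  {zero}  _    _    _  = refl
  point-injective-C {zero}  {suc j} _    j∈C  eq = ⊥-elim (x∉F (subst (_∈ F) (sym eq) (toWitness j∈C)))
  point-injective-C {suc i} {zero}  i∈C  _    eq = ⊥-elim (x∉F (subst (_∈ F) eq (toWitness i∈C)))
  point-injective-C {suc i} {suc j} _    _    eq = cong suc (elem-injective eq)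

  open FreeAmalgam U point inB inC

  -- This and the two
  -- automorphisms below are opaque: only their stated properties matter,
  -- and unfolding their proofs would make type checking needlessly slow.
  opaque
    D-in-age : Age U Amalgam
    D-in-age = amalgam-in-age fac covers point-injective-B point-injective-C

  E : Fin (suc size) → Carrier U
  E = proj₁ (proj₂ D-in-age)

  E-injective : Injective _≡_ _≡_ E
  E-injective = proj₁ (proj₂ (proj₂ D-in-age))

  E-rel : ∀ s (t : Fin (arity L s) → Fin (suc size)) → Rel Amalgam s t ⇔ Rel U s (E ∘ t)
  E-rel = proj₂ (proj₂ (proj₂ D-in-age))

  opaque
    h-ext : Σ (Automorphism U) (λ h → ∀ i → T (inB i) → aut h (E i) ≡ point i)
    h-ext = extend-on U hom inB E point (λ _ _ → E-injective) point-injective-B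
      (λ s t w → ⇔.trans (⇔.sym (E-rel s t)) (within-part (inj₁ w)))

  h : Automorphism U
  h = proj₁ h-ext

  h∘E : Fin (suc size) → Carrier U
  h∘E = aut h ∘ E

  h∘E-injective : Injective _≡_ _≡_ h∘E
  h∘E-injective = E-injective ∘ aut-injective U h

  opaque
    g-ext : Σ (Automorphism U) (λ g → ∀ i → T (inC i) → aut g (point i) ≡ h∘E i)
    g-ext = extend-on U hom inC point h∘E point-injective-C (λ _ _ → h∘E-injective)
      (λ s t w → ⇔.trans (⇔.sym (within-part (inj₂ w)))
                 (⇔.trans (E-rel s t) (Automorphism.preserve h s (E ∘ t))))

  g : Automorphism U
  g = proj₁ g-ext

  y : Carrier U
  y = h∘E zero

  -- If y = elem j lay in l, then h (E (suc j)) = y = h (E ∗), contradicting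
  -- injectivity of h ∘ E.
  y∉l : y ∉ l
  y∉l y∈l with elem-covers (∈-++⁺ʳ F y∈l)
  ... | j , elem-j≡y with h∘E-injective (trans (proj₂ h-ext (suc j) tt) elem-j≡y)
  ... | ()

  -- Points of F lie in both B and C, where h ∘ E undoes point.
  g-fixes-F : ∀ f → f ∈ F → aut g f ≡ f
  g-fixes-F f f∈F with elem-covers (∈-++⁺ˡ f∈F)
  ... | j , elem-j≡f = begin
    aut g f               ≡⟨ cong (aut g) (sym elem-j≡f) ⟩
    aut g (point (suc j)) ≡⟨ proj₂ g-ext (suc j) j∈C ⟩
    h∘E (suc j)           ≡⟨ proj₂ h-ext (suc j) tt ⟩
    elem j                ≡⟨ elem-j≡f ⟩
    f                     ∎
    where
    open ≡-Reasoning
    j∈C : T (inC (suc j))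
    j∈C = fromWitness (subst (_∈ F) (sym elem-j≡f) f∈F)

  y-in-typeset : InTypeset U F x y
  y-in-typeset = g , g-fixes-F , proj₂ g-ext zero tt

-- A finite cover l of the typeset would have to contain y.  (The hypothesis
-- that relations hold only on distinct entries is not needed.)
corollary4p1 : (L : Language) (U : Structure L) →
    Countable U → RelationsOnDistinct U → Homogeneous U →
    IsFreeAmalgamationClass (Age U) →
    (F : List (Carrier U)) (x : Carrier U) → x ∉ F →
    Infinite U (InTypeset U F x)
corollary4p1 L U cnt _ hom fac F x x∉F (l , l-covers) = y∉l (l-covers y y-in-typeset)
  where open TypesetInfinite U cnt hom fac F x x∉F l
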